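{- Let $(G,H)$ be dense and let $u\in V(G)$. Then there exists an orientation $O$ of $G$ such that $d^+_O(v)\in H(v)$ for all $v\in V(G)\setminus\{u\}$.
   Context: $G$ is a graph without loops, $H:V(G)\to 2^{\mathbb{N}}$, and $d^+_O(v)$ denotes the out-degree of $v$ under orientation $O$. The pair $(G,H)$ is dense if $G$ is connected and for every $v\in V(G)$ and every integer $i$ with $0\le i\le d_G(v)-1$: if $i\notin H(v)$ then $i+1\in H(v)$. -}

module Defs where

open import Data.Nat using (ℕ; suc; _<_)
open import Data.Fin using (Fin; _≟_)
open import Data.List using (List; length; filter; allFin)
open import Data.Bool using (Bool; true; false; if_then_else_)
open import Data.Product using (Σ; _×_; _,_; ∃)
open import Data.Sum using (_⊎_; inj₁; inj₂)
open import Relation.Binary.PropositionalEquality using (_≡_)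
open import Relation.Nullary using (¬_)
open import Relation.Nullary.Decidable using (_⊎-dec_)
open import Relation.Binary.Construct.Closure.ReflexiveTransitive using (Star)

record Graph : Set where
  field
    n     : ℕ
    m     : ℕ
    end₁  : Fin m → Fin n
    end₂  : Fin m → Fin n
    loopless : (e : Fin m) → ¬ (end₁ e ≡ end₂ e)

open Graph public

Vertex : Graph → Set
Vertex G = Fin (n G)

Edge : Graph → Set
Edge G = Fin (m G)

Adjacent : (G : Graph) → Vertex G → Vertex G → Set
Adjacent G x y = ∃ λ (e : Edge G) →
  (end₁ G e ≡ x × end₂ G e ≡ y) ⊎ (end₁ G e ≡ y × end₂ G e ≡ x)

Connected : Graph → Set
Connected G = (x y : Vertex G) → Star (Adjacent G) x y

-- degree: number of edges incident with v (no loops, so each counted once)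
deg : (G : Graph) → Vertex G → ℕ
deg G v = length (filter (λ e → (end₁ G e ≟ v) ⊎-dec (end₂ G e ≟ v)) (allFin (m G)))

-- an orientation chooses for each edge a direction:
-- true  : end₁ e → end₂ e ;  false : end₂ e → end₁ e
Orientation : Graph → Set
Orientation G = Edge G → Bool

tail : (G : Graph) → Orientation G → Edge G → Vertex G
tail G O e = if O e then end₁ G e else end₂ G e

outdeg : (G : Graph) → Orientation G → Vertex G → ℕ
outdeg G O v = length (filter (λ e → tail G O e ≟ v) (allFin (m G)))

Subsetℕ : Set
Subsetℕ = ℕ → Bool

_∈ℕ_ : ℕ → Subsetℕ → Set
i ∈ℕ S = S i ≡ true

Dense : (G : Graph) → (Vertex G → Subsetℕ) → Set
Dense G H = Connected G ×
  ((v : Vertex G) (i : ℕ) → i < deg G v → ¬ (i ∈ℕ H v) → suc i ∈ℕ H v)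

{-# OPTIONS --safe #-}
-- Let layer k consist of the vertices at distance k from u.  Going inwards
-- from the outermost layer, every vertex x of the current layer gets its
-- outdegree into H(x) by reversing, if necessary, one edge from x to the next
-- inner layer.  The reversal moves the outdegree of x by one, and density says
-- that if a ∉ H(x) then a ± 1 ∈ H(x) whenever both lie in [0, deg x].  Only the
-- inner endpoint is disturbed, and it is dealt with later or is u itself.
module Submission where

open import Data.Bool using (true; false; not)
import Data.Bool as Bool
open import Data.Empty using (⊥-elim)
open import Data.Fin using (Fin; zero; suc; _≟_; punchIn)
open import Data.Fin.Properties using (any?; punchInᵢ≢i)
open import Data.List using (List; []; _∷_; length; filter; tabulate; allFin)
open import Data.List.Extrema.Nat using (argmax; f[xs]≤f[argmax])
open import Data.List.Membership.Propositional using (_∈_; _∉_)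
open import Data.List.Membership.Propositional.Properties using (∈-allFin; ∈-filter⁺; ∈-filter⁻)
open import Data.List.Relation.Binary.Sublist.Propositional using (⊆-refl)
open import Data.List.Relation.Binary.Sublist.Propositional.Properties using (filter⁺; length-mono-≤)
import Data.List.Relation.Unary.All as All
open import Data.List.Relation.Unary.Any using (here; there)
open import Data.Nat using (ℕ; zero; suc; _+_; _≤_; _<_; _≤′_; ≤′-refl; ≤′-step)
open import Data.Nat.Properties using (+-0-commutativeMonoid; +-identityʳ; +-comm; ≤⇒≤′)
open import Data.Nat.Solver using (module +-*-Solver)
open import Data.Product using (Σ; _×_; _,_; proj₁; proj₂; ∃)
open import Data.Sum using (_⊎_; inj₁; inj₂; [_,_])
open import Data.Vec.Functional using (removeAt; updateAt)
open import Data.Vec.Functional.Properties using (updateAt-updates; updateAt-minimal)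
open import Function using (_∘_; id)
open import Relation.Binary.Construct.Closure.ReflexiveTransitive using (Star; ε; _◅_)
open import Relation.Binary.PropositionalEquality
  using (_≡_; _≢_; _≗_; refl; sym; trans; cong; subst; module ≡-Reasoning)
open import Relation.Nullary using (Dec; yes; no; ¬_; ¬?)
open import Relation.Nullary.Decidable using (_⊎-dec_; _×-dec_)

open import Defs
open import Algebra.Properties.CommutativeMonoid.Sum +-0-commutativeMonoid using (sum; sum-remove; sum-cong-≗)

indicator : ∀ {a} {A : Set a} → Dec A → ℕ
indicator (yes _) = 1
indicator (no _)  = 0

fibreSize : ∀ {m n} → (Fin m → Fin n) → Fin n → ℕ
fibreSize {m} f v = length (filter (λ i → f i ≟ v) (allFin m))

length-filter-tabulate : ∀ {a} {A : Set a} {p} {P : A → Set p} (P? : ∀ x → Dec (P x)) {m} (f : Fin m → A) →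
  length (filter P? (tabulate f)) ≡ sum (λ i → indicator (P? (f i)))
length-filter-tabulate P? {zero}  f = refl
length-filter-tabulate P? {suc m} f with P? (f zero)
... | yes _ = cong suc (length-filter-tabulate P? (λ i → f (suc i)))
... | no  _ = length-filter-tabulate P? (λ i → f (suc i))

-- Both indicators are added, so that no truncated subtraction occurs.
fibreSize-exchange : ∀ {m n} (f g : Fin m → Fin n) (e : Fin m) (v : Fin n) →
  (∀ i → i ≢ e → f i ≡ g i) →
  fibreSize f v + indicator (g e ≟ v) ≡ fibreSize g v + indicator (f e ≟ v)
fibreSize-exchange {suc m} {n} f g e v agree = begin
  fibreSize f v + b               ≡⟨ cong (_+ b) (split f) ⟩
  a + sum (removeAt ι[ f ] e) + b ≡⟨ cong (λ r → a + r + b) (sum-cong-≗ rest-agree) ⟩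
  a + r + b                       ≡⟨ solve 3 (λ a r b → a :+ r :+ b := b :+ r :+ a) refl a r b ⟩
  b + r + a                       ≡⟨ cong (_+ a) (sym (split g)) ⟩
  fibreSize g v + a               ∎
  where
  open ≡-Reasoning
  open +-*-Solver
  ι[_] : (Fin (suc m) → Fin n) → Fin (suc m) → ℕ
  ι[ h ] i = indicator (h i ≟ v)
  a b r : ℕ
  a = ι[ f ] e
  b = ι[ g ] e
  r = sum (removeAt ι[ g ] e)
  split : ∀ h → fibreSize h v ≡ ι[ h ] e + sum (removeAt ι[ h ] e)
  split h = trans (length-filter-tabulate (λ i → h i ≟ v) (λ i → i)) (sum-remove ι[ h ])
  rest-agree : removeAt ι[ f ] e ≗ removeAt ι[ g ] e
  rest-agree i = cong (λ w → indicator (w ≟ v)) (agree (punchIn e i) (punchInᵢ≢i e i))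

module Reversal (G : Graph) where

  Incident : Edge G → Vertex G → Set
  Incident e v = end₁ G e ≡ v ⊎ end₂ G e ≡ v

  reverse : Orientation G → Edge G → Orientation G
  reverse O e = updateAt O e not

  tail-incident : ∀ O e → Incident e (tail G O e)
  tail-incident O e with O e
  ... | true  = inj₁ refl
  ... | false = inj₂ refl

  tail-reverse-other : ∀ O {e e′} → e′ ≢ e → tail G (reverse O e) e′ ≡ tail G O e′
  tail-reverse-other O {e} {e′} e′≢e rewrite updateAt-minimal e′ e {not} O e′≢e = refl

  tail-reverse-≢ : ∀ O e → tail G (reverse O e) e ≢ tail G O e
  tail-reverse-≢ O e rewrite updateAt-updates e {not} O with O e
  ... | true  = loopless G e ∘ sym
  ... | false = loopless G e

  tail-reverse-incident : ∀ O {e v} → Incident e v → tail G O e ≢ v → tail G (reverse O e) e ≡ v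
  tail-reverse-incident O {e} ends tail≢v rewrite updateAt-updates e {not} O with O e | ends
  ... | true  | inj₁ p = ⊥-elim (tail≢v p)
  ... | true  | inj₂ p = p
  ... | false | inj₁ p = p
  ... | false | inj₂ p = ⊥-elim (tail≢v p)

  outdeg≤deg : ∀ O v → outdeg G O v ≤ deg G v
  outdeg≤deg O v = length-mono-≤ (filter⁺ (λ e → tail G O e ≟ v) (λ e → (end₁ G e ≟ v) ⊎-dec (end₂ G e ≟ v))
    (λ { refl refl → tail-incident O _ }) (⊆-refl {x = allFin (m G)}))

  outdeg-reverse : ∀ O e v → outdeg G O v + indicator (tail G (reverse O e) e ≟ v)
                            ≡ outdeg G (reverse O e) v + indicator (tail G O e ≟ v)
  outdeg-reverse O e v = fibreSize-exchange (tail G O) (tail G (reverse O e)) e v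
    (λ i i≢e → sym (tail-reverse-other O i≢e))

  outdeg-reverse-nonincident : ∀ O e {v} → ¬ Incident e v → outdeg G (reverse O e) v ≡ outdeg G O v
  outdeg-reverse-nonincident O e {v} ¬inc
    with tail G (reverse O e) e ≟ v | tail G O e ≟ v | outdeg-reverse O e v
  ... | yes p | _     | _  = ⊥-elim (¬inc (subst (Incident e) p (tail-incident (reverse O e) e)))
  ... | no _  | yes p | _  = ⊥-elim (¬inc (subst (Incident e) p (tail-incident O e)))
  ... | no _  | no _  | eq = sym (trans (sym (+-identityʳ _)) (trans eq (+-identityʳ _)))

  outdeg-reverse-incident : ∀ O e {v} → Incident e v →
    outdeg G O v ≡ suc (outdeg G (reverse O e) v) ⊎ outdeg G (reverse O e) v ≡ suc (outdeg G O v)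
  outdeg-reverse-incident O e {v} inc
    with tail G (reverse O e) e ≟ v | tail G O e ≟ v | outdeg-reverse O e v
  ... | yes p | yes q | _  = ⊥-elim (tail-reverse-≢ O e (trans p (sym q)))
  ... | no _  | yes _ | eq = inj₁ (trans (sym (+-identityʳ _)) (trans eq (+-comm _ 1)))
  ... | yes _ | no _  | eq = inj₂ (trans (sym (+-identityʳ _)) (trans (sym eq) (+-comm _ 1)))
  ... | no p  | no q  | _  = ⊥-elim (p (tail-reverse-incident O inc q))

  adjacent-incident : ∀ {x w} (adj : Adjacent G x w) → Incident (proj₁ adj) x
  adjacent-incident (e , inj₁ (p , _)) = inj₁ p
  adjacent-incident (e , inj₂ (_ , q)) = inj₂ q

  incident-adjacent : ∀ {x w v} (adj : Adjacent G x w) → Incident (proj₁ adj) v → v ≡ x ⊎ v ≡ w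
  incident-adjacent (e , inj₁ (refl , refl)) (inj₁ refl) = inj₁ refl
  incident-adjacent (e , inj₁ (refl , refl)) (inj₂ refl) = inj₂ refl
  incident-adjacent (e , inj₂ (refl , refl)) (inj₁ refl) = inj₂ refl
  incident-adjacent (e , inj₂ (refl , refl)) (inj₂ refl) = inj₁ refl

GapFreeBelow : ℕ → Subsetℕ → Set
GapFreeBelow d S = ∀ i → i < d → ¬ i ∈ℕ S → suc i ∈ℕ S

gapFree-neighbour : ∀ {d S a b} → GapFreeBelow d S → a ≤ d → b ≤ d →
  a ≡ suc b ⊎ b ≡ suc a → ¬ a ∈ℕ S → b ∈ℕ S
gapFree-neighbour {a = a} gapFree _   b≤d (inj₂ refl) a∉S = gapFree a b≤d a∉S
gapFree-neighbour {S = S} {b = b} gapFree a≤d _ (inj₁ refl) a∉S with S b Bool.≟ true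
... | yes b∈S = b∈S
... | no  b∉S = ⊥-elim (a∉S (gapFree b a≤d b∉S))

module Repair (G : Graph) (H : Vertex G → Subsetℕ) (gapFree : ∀ v → GapFreeBelow (deg G v) (H v)) where

  open Reversal G

  Good : Orientation G → Vertex G → Set
  Good O v = outdeg G O v ∈ℕ H v

  repair : ∀ O {x w} → Adjacent G x w →
    Σ (Orientation G) λ O′ → Good O′ x × (∀ v → v ≢ x → v ≢ w → outdeg G O′ v ≡ outdeg G O v)
  repair O {x} {w} adj@(e , _) with H x (outdeg G O x) Bool.≟ true
  ... | yes good = O , good , λ _ _ _ → refl
  ... | no  bad  = reverse O e , good′ , unchanged
    where
    good′ : Good (reverse O e) x
    good′ = gapFree-neighbour (gapFree x) (outdeg≤deg O x) (outdeg≤deg (reverse O e) x)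
      (outdeg-reverse-incident O e (adjacent-incident adj)) bad
    unchanged : ∀ v → v ≢ x → v ≢ w → outdeg G (reverse O e) v ≡ outdeg G O v
    unchanged v v≢x v≢w = outdeg-reverse-nonincident O e
      λ inc → [ v≢x , v≢w ] (incident-adjacent adj inc)

  repair-all : ∀ {D : Vertex G → Set} (L : List (Vertex G)) O →
    (∀ {x} → x ∈ L → ∃ λ w → Adjacent G x w × D w) →
    (∀ v → ¬ D v → v ∉ L → Good O v) →
    Σ (Orientation G) λ O′ → ∀ v → ¬ D v → Good O′ v
  repair-all []      O anchored good = O , λ v v∉D → good v v∉D λ ()
  repair-all {D} (x ∷ L) O anchored good with anchored (here refl)
  ... | w , adj , w∈D with repair O adj
  ...   | O′ , good-x , unchanged = repair-all L O′ (anchored ∘ there) good′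
    where
    good′ : ∀ v → ¬ D v → v ∉ L → Good O′ v
    good′ v v∉D v∉L with v ≟ x
    ... | yes refl = good-x
    ... | no  v≢x  = subst (_∈ℕ H v) (sym (unchanged v v≢x λ { refl → v∉D w∈D }))
                       (good v v∉D λ { (here v≡x) → v≢x v≡x ; (there v∈L) → v∉L v∈L })

module Layers (G : Graph) (u : Vertex G) where

  Near : ℕ → Vertex G → Set
  Near zero    v = v ≡ u
  Near (suc k) v = Near k v ⊎ ∃ λ w → Adjacent G v w × Near k w

  adjacent? : ∀ x y → Dec (Adjacent G x y)
  adjacent? x y = any? λ e → ((end₁ G e ≟ x) ×-dec (end₂ G e ≟ y)) ⊎-dec ((end₁ G e ≟ y) ×-dec (end₂ G e ≟ x))

  near? : ∀ k v → Dec (Near k v)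
  near? zero    v = v ≟ u
  near? (suc k) v = near? k v ⊎-dec any? λ w → adjacent? v w ×-dec near? k w

  near-mono : ∀ {k l v} → k ≤′ l → Near k v → Near l v
  near-mono ≤′-refl       = id
  near-mono (≤′-step k≤l) = inj₁ ∘ near-mono k≤l

  walk⇒near : ∀ {v} → Star (Adjacent G) v u → ∃ λ k → Near k v
  walk⇒near ε            = 0 , refl
  walk⇒near (adj ◅ walk) with walk⇒near walk
  ... | k , near = suc k , inj₂ (_ , adj , near)

  connected⇒near : Connected G → ∃ λ k → ∀ v → Near k v
  connected⇒near connected = distance (argmax distance u (allFin (n G))) , λ v →
      near-mono (≤⇒≤′ (All.lookup (f[xs]≤f[argmax] u (allFin (n G))) (∈-allFin v))) (proj₂ (walk v))
    where
    walk : ∀ v → ∃ λ k → Near k v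
    walk v = walk⇒near (connected v u)
    distance : Vertex G → ℕ
    distance v = proj₁ (walk v)

module Descent (G : Graph) (H : Vertex G → Subsetℕ) (gapFree : ∀ v → GapFreeBelow (deg G v) (H v))
               (u : Vertex G) where

  open Repair G H gapFree
  open Layers G u

  GoodOutside : ℕ → Set
  GoodOutside k = Σ (Orientation G) λ O → ∀ v → ¬ Near k v → Good O v

  layer-step : ∀ k → GoodOutside (suc k) → GoodOutside k
  layer-step k (O , good) = repair-all layer O anchored good′
    where
    layer? : ∀ v → Dec (Near (suc k) v × ¬ Near k v)
    layer? v = near? (suc k) v ×-dec ¬? (near? k v)
    layer : List (Vertex G)
    layer = filter layer? (allFin (n G))
    anchored : ∀ {x} → x ∈ layer → ∃ λ w → Adjacent G x w × Near k w
    anchored x∈layer with ∈-filter⁻ layer? {xs = allFin (n G)} x∈layer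
    ... | _ , inj₁ near , far = ⊥-elim (far near)
    ... | _ , inj₂ edge , _   = edge
    good′ : ∀ v → ¬ Near k v → v ∉ layer → Good O v
    good′ v far v∉layer = good v λ near → v∉layer (∈-filter⁺ layer? (∈-allFin v) (near , far))

  goodOutside-zero : ∀ k → GoodOutside k → GoodOutside 0
  goodOutside-zero zero    = id
  goodOutside-zero (suc k) = goodOutside-zero k ∘ layer-step k

lemma2p1 : (G : Graph) (H : Vertex G → Subsetℕ) → Dense G H → (u : Vertex G) →
    Σ (Orientation G) λ O → (v : Vertex G) → ¬ (v ≡ u) → outdeg G O v ∈ℕ H v
lemma2p1 G H (connected , gapFree) u with Layers.connected⇒near G u connected
... | radius , everywhere-near =
  Descent.goodOutside-zero G H gapFree u radius ((λ _ → true) , λ v far → ⊥-elim (far (everywhere-near v)))
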